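{- Let $G$ and $H$ be connected graphs and let $A \subseteq V(G)$, regarded as a subset of $V(G \odot H)$. Then $A$ is a mutual-visibility set of $G \odot H$ if and only if $A$ is a mutual-visibility set of $G$.
   Context: All graphs are finite, simple, undirected and connected. For a graph $G$ and $X \subseteq V(G)$, two vertices $u,v$ are $X$-visible if there exists a shortest $(u,v)$-path $P$ in $G$ with $V(P)\cap X \subseteq \{u,v\}$. A set $X\subseteq V(G)$ is a mutual-visibility set of $G$ if every two vertices of $X$ are $X$-visible. The corona $G\odot H$ is obtained from one copy of $G$ and $|V(G)|$ copies of $H$, the copy associated with $v\in V(G)$ being denoted $H_v$, by joining each $v \in V(G)$ to every vertex of $H_v$. -}

module Defs where

open import Data.Nat using (ℕ; zero; suc; _≤_)
open import Data.Product using (Σ; _×_; _,_; ∃)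
open import Data.Sum using (_⊎_; inj₁; inj₂)
open import Data.Empty using (⊥)
open import Data.List using (List; []; _∷_)
open import Data.List.Membership.Propositional using (_∈_)
open import Data.List.Relation.Unary.All using (All)
open import Relation.Nullary using (¬_)
open import Relation.Binary.PropositionalEquality using (_≡_; refl)
open import Function using (_⇔_)

record Graph : Set₁ where
  field
    V      : Set
    E      : V → V → Set
    sym    : ∀ {u v} → E u v → E v u
    irrefl : ∀ {v} → ¬ E v v
open Graph public

Finite : Graph → Set
Finite G = Σ (List (V G)) λ l → ∀ v → v ∈ l

data Walk (G : Graph) : V G → V G → Set where
  []  : ∀ {u} → Walk G u u
  _∷_ : ∀ {u w v} → E G u w → Walk G w v → Walk G u v

length : ∀ {G u v} → Walk G u v → ℕ
length []      = zero
length (_ ∷ p) = suc (length p)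

verts : ∀ {G u v} → Walk G u v → List (V G)
verts {u = u} []      = u ∷ []
verts {u = u} (_ ∷ p) = u ∷ verts p

Connected : Graph → Set
Connected G = ∀ (u v : V G) → Walk G u v

-- A shortest (u,v)-walk (necessarily a path).
Shortest : ∀ {G u v} → Walk G u v → Set
Shortest {G} {u} {v} p = ∀ (q : Walk G u v) → length p ≤ length q

Visible : (G : Graph) → (V G → Set) → V G → V G → Set
Visible G X u v =
  Σ (Walk G u v) λ p → Shortest p × All (λ x → X x → (x ≡ u) ⊎ (x ≡ v)) (verts p)

MutualVisibilitySet : (G : Graph) → (V G → Set) → Set
MutualVisibilitySet G X = ∀ (u v : V G) → X u → X v → Visible G X u v

-- Corona G ⊙ H: vertices of G (inj₁ v) and, for each v, a copy H_v of H
-- (vertices inj₂ (v , h)).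
module _ (G H : Graph) where
  CV : Set
  CV = V G ⊎ (V G × V H)

  data CE : CV → CV → Set where
    gg  : ∀ {a b} → E G a b → CE (inj₁ a) (inj₁ b)
    gh  : ∀ {v h} → CE (inj₁ v) (inj₂ (v , h))
    hg  : ∀ {v h} → CE (inj₂ (v , h)) (inj₁ v)
    hh  : ∀ {v h h'} → E H h h' → CE (inj₂ (v , h)) (inj₂ (v , h'))

  CE-sym : ∀ {x y} → CE x y → CE y x
  CE-sym (gg e) = gg (sym G e)
  CE-sym gh = hg
  CE-sym hg = gh
  CE-sym (hh e) = hh (sym H e)

  CE-irrefl : ∀ {x} → ¬ CE x x
  CE-irrefl (gg e) = irrefl G e
  CE-irrefl (hh e) = irrefl H e

corona : Graph → Graph → Graph
corona G H = record
  { V = CV G H ; E = CE G H ; sym = CE-sym G H ; irrefl = CE-irrefl G H }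

embed : (G H : Graph) → (V G → Set) → V (corona G H) → Set
embed G H A (inj₁ v) = A v
embed G H A (inj₂ _) = ⊥

{-# OPTIONS --safe #-}
-- Collapsing every copy H_v onto v maps each edge of G ⊙ H to an edge of G or
-- to a single vertex, and is a left inverse of the inclusion of G. Hence the inclusion is
-- isometric: shortest (u,v)-paths of G stay shortest in G ⊙ H, and shortest
-- (u,v)-paths of G ⊙ H project to shortest paths of G. Since A contains no
-- vertex of any H_v, a path avoids A internally iff its projection does.
module Submission where

open import Defs
open import Function using (_⇔_; mk⇔; _∘_)
open import Data.Nat using (suc; _≤_; z≤n; s≤s)
open import Data.Nat.Properties using (m≤n⇒m≤1+n; module ≤-Reasoning)
open import Data.Product using (_,_)
open import Data.Sum using (_⊎_; inj₁; inj₂; map)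
open import Data.Sum.Properties using (inj₁-injective)
open import Data.List.Relation.Unary.All using (All; []; _∷_)
open import Relation.Binary.PropositionalEquality using (_≡_; refl; cong)

module _ (G H : Graph) where

  π : V (corona G H) → V G
  π (inj₁ v)       = v
  π (inj₂ (v , _)) = v

  project : ∀ {x y} → Walk (corona G H) x y → Walk G (π x) (π y)
  project []         = []
  project (gg e ∷ p) = e ∷ project p
  project (gh ∷ p)   = project p
  project (hg ∷ p)   = project p
  project (hh _ ∷ p) = project p

  length-project : ∀ {x y} (p : Walk (corona G H) x y) → length (project p) ≤ length p
  length-project []         = z≤n
  length-project (gg _ ∷ p) = s≤s (length-project p)
  length-project (gh ∷ p)   = m≤n⇒m≤1+n (length-project p)
  length-project (hg ∷ p)   = m≤n⇒m≤1+n (length-project p)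
  length-project (hh _ ∷ p) = m≤n⇒m≤1+n (length-project p)

  lift : ∀ {u v} → Walk G u v → Walk (corona G H) (inj₁ u) (inj₁ v)
  lift []      = []
  lift (e ∷ p) = gg e ∷ lift p

  length-lift : ∀ {u v} (p : Walk G u v) → length (lift p) ≡ length p
  length-lift []      = refl
  length-lift (_ ∷ p) = cong suc (length-lift p)

  shortest-lift : ∀ {u v} {p : Walk G u v} → Shortest p → Shortest (lift p)
  shortest-lift {p = p} p-shortest q = begin
    length (lift p)    ≡⟨ length-lift p ⟩
    length p           ≤⟨ p-shortest (project q) ⟩
    length (project q) ≤⟨ length-project q ⟩
    length q           ∎
    where open ≤-Reasoning

  shortest-project : ∀ {u v} {p : Walk (corona G H) (inj₁ u) (inj₁ v)} →
    Shortest p → Shortest (project p)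
  shortest-project {p = p} p-shortest q = begin
    length (project p) ≤⟨ length-project p ⟩
    length p           ≤⟨ p-shortest (lift q) ⟩
    length (lift q)    ≡⟨ length-lift q ⟩
    length q           ∎
    where open ≤-Reasoning

  All-head : ∀ {Q : V (corona G H) → Set} {x y} (p : Walk (corona G H) x y) →
    All Q (verts p) → Q x
  All-head []      (qx ∷ _) = qx
  All-head (_ ∷ _) (qx ∷ _) = qx

  -- The only vertices of project p besides π x are those of G visited by p.
  All-project : ∀ {Q : V (corona G H) → Set} {R : V G → Set} →
    (∀ z → Q (inj₁ z) → R z) →
    ∀ {x y} (p : Walk (corona G H) x y) → All Q (verts p) → R (π x) →
    All R (verts (project p))
  All-project Q⇒R []                 _        rx = rx ∷ []
  All-project Q⇒R (gg {b = b} _ ∷ p) (_ ∷ qs) rx =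
    rx ∷ All-project Q⇒R p qs (Q⇒R b (All-head p qs))
  All-project Q⇒R (gh ∷ p)           (_ ∷ qs) rx = All-project Q⇒R p qs rx
  All-project Q⇒R (hg ∷ p)           (_ ∷ qs) rx = All-project Q⇒R p qs rx
  All-project Q⇒R (hh _ ∷ p)         (_ ∷ qs) rx = All-project Q⇒R p qs rx

  All-lift : ∀ {Q : V (corona G H) → Set} {R : V G → Set} →
    (∀ z → R z → Q (inj₁ z)) →
    ∀ {u v} (p : Walk G u v) → All R (verts p) → All Q (verts (lift p))
  All-lift R⇒Q []      (r ∷ []) = R⇒Q _ r ∷ []
  All-lift R⇒Q (_ ∷ p) (r ∷ rs) = R⇒Q _ r ∷ All-lift R⇒Q p rs

  module _ (A : V G → Set) {u v : V G} where

    visible-project : Visible (corona G H) (embed G H A) (inj₁ u) (inj₁ v) → Visible G A u v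
    visible-project (p , p-shortest , avoids) =
      project p , shortest-project p-shortest , All-project inner p avoids (λ _ → inj₁ refl)
      where
      inner : ∀ z → (A z → (inj₁ z ≡ inj₁ u) ⊎ (inj₁ z ≡ inj₁ v)) → A z → (z ≡ u) ⊎ (z ≡ v)
      inner _ endpoint = map inj₁-injective inj₁-injective ∘ endpoint

    visible-lift : Visible G A u v → Visible (corona G H) (embed G H A) (inj₁ u) (inj₁ v)
    visible-lift (p , p-shortest , avoids) =
      lift p , shortest-lift p-shortest , All-lift inner p avoids
      where
      inner : ∀ z → (A z → (z ≡ u) ⊎ (z ≡ v)) → A z → (inj₁ z ≡ inj₁ u) ⊎ (inj₁ z ≡ inj₁ v)
      inner _ endpoint = map (cong inj₁) (cong inj₁) ∘ endpoint

  mutualVisibility-restrict : (A : V G → Set) →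
    MutualVisibilitySet (corona G H) (embed G H A) → MutualVisibilitySet G A
  mutualVisibility-restrict A mv u v au av = visible-project A (mv (inj₁ u) (inj₁ v) au av)

  mutualVisibility-corona : (A : V G → Set) →
    MutualVisibilitySet G A → MutualVisibilitySet (corona G H) (embed G H A)
  mutualVisibility-corona A mv (inj₁ u) (inj₁ v) au av = visible-lift A (mv u v au av)
  mutualVisibility-corona A mv (inj₁ _) (inj₂ _) _  ()
  mutualVisibility-corona A mv (inj₂ _) _        () _

mainTheorem1 : (G H : Graph) → Finite G → Finite H → Connected G → Connected H →
    (A : V G → Set) →
    MutualVisibilitySet (corona G H) (embed G H A) ⇔ MutualVisibilitySet G A
mainTheorem1 G H _ _ _ _ A =
  mk⇔ (mutualVisibility-restrict G H A) (mutualVisibility-corona G H A)
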